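{- For every single-elimination tournament $\mathcal{T}$ with at least $2$ players and any scoring system $\sigma$ on $\mathcal{T}$, \[\dim(\mathcal{T},\sigma)\ge \max_{x\in M(\mathcal{T})}\Big(|P(x)|-\max_{u\in N^-(x)}|P(u)|\Big).\] Moreover, for every such $\mathcal{T}$ there exists a scoring system $\sigma$ for which equality holds.
   Context: For a digraph, $N^+(v)$ is the set of out-neighbours of $v$ and $N^-(v)$ the set of in-neighbours; a sink has $N^+(v)=\emptyset$, a source has $N^-(v)=\emptyset$. A single-elimination tournament $\mathcal{T}$ is a finite digraph with: exactly one sink; $|N^+(v)|=1$ for every non-sink $v$; no directed cycles; and $|N^-(v)|\ne 1$ for every vertex $v$. Players $P(\mathcal{T})$ are the sources; matches $M(\mathcal{T})$ are the non-sources. A directed walk from $u_1$ to $u_t$ is a sequence $(u_1,\dots,u_t)$, $t\ge1$, with $u_{i+1}\in N^+(u_i)$; for a vertex $u$, the player set $P(u)$ is the set of players $a$ having a directed walk from $a$ to $u$. A bracket is a function $B:V(\mathcal{T})\to P(\mathcal{T})$ with $B(a)=a$ for every player $a$ and $B(x)\in\{B(u):u\in N^-(x)\}$ for every match $x$. A scoring system is a function $\sigma:M(\mathcal{T})\to\mathbb{R}_{>0}$. For brackets $B,B'$, $\mathrm{score}_\sigma(B,B')=\sum_{x\in M(\mathcal{T}):B(x)=B'(x)}\sigma(x)$. A set of brackets $\mathcal{B}$ is $\sigma$-resolving if for all pairs of distinct brackets $B,B'$ there is $B_i\in\mathcal{B}$ with $\mathrm{score}_\sigma(B_i,B)\ne\mathrm{score}_\sigma(B_i,B')$.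 $\dim(\mathcal{T},\sigma)$ is the minimum size of a $\sigma$-resolving set. -}

module Defs where

open import Data.Nat using (ℕ; zero; suc; _∸_; _⊔_)
open import Data.Bool using (Bool; true; false; _∧_; not; if_then_else_)
open import Data.Fin using (Fin; _≟_)
open import Data.List using (List; []; _∷_; length; filter; map; foldr; allFin)
open import Data.List.Membership.Propositional using (_∈_)
open import Data.List.Relation.Unary.Unique.Propositional using (Unique)
open import Data.Product using (Σ; ∃; ∃-syntax; _×_; _,_)
open import Data.Sum using (_⊎_)
open import Relation.Nullary using (¬_; does)
open import Relation.Binary.PropositionalEquality using (_≡_)
open import Function.Bundles using (_⇔_)
open import Algebra.Structures using (IsCommutativeRing)
open import Relation.Binary.Structures using (IsStrictTotalOrder)

-- The real numbers, axiomatised as a complete ordered field.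
-- (agda-stdlib has no real numbers; every model of these axioms is
-- isomorphic to ℝ.)

record RealField : Set₁ where
  infixl 6 _+_
  infixl 7 _*_
  infix 4 _≈_ _<_ _≤_
  field
    Carrier : Set
    _≈_ : Carrier → Carrier → Set
    _+_ : Carrier → Carrier → Carrier
    _*_ : Carrier → Carrier → Carrier
    -_  : Carrier → Carrier
    0#  : Carrier
    1#  : Carrier
    _<_ : Carrier → Carrier → Set
    isCommutativeRing  : IsCommutativeRing _≈_ _+_ _*_ -_ 0# 1#
    isStrictTotalOrder : IsStrictTotalOrder _≈_ _<_
    0≉1      : ¬ (0# ≈ 1#)
    inverse  : ∀ x → ¬ (x ≈ 0#) → ∃[ y ] (x * y ≈ 1#)
    +-mono-< : ∀ {x y} z → x < y → x + z < y + z
    *-pos    : ∀ {x y} → 0# < x → 0# < y → 0# < x * y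

  _≤_ : Carrier → Carrier → Set
  x ≤ y = x < y ⊎ x ≈ y

  IsUpperBound : (Carrier → Set) → Carrier → Set
  IsUpperBound S b = ∀ x → S x → x ≤ b

  field
    lub : (S : Carrier → Set) → ∃[ x ] S x → ∃[ b ] IsUpperBound S b →
          ∃[ s ] (IsUpperBound S s × (∀ b → IsUpperBound S b → s ≤ b))

record Digraph : Set where
  field
    n   : ℕ
    adj : Fin n → Fin n → Bool

module _ (G : Digraph) where
  open Digraph G

  count : (Fin n → Bool) → ℕ
  count p = length (filter (λ v → p v ≟ᵇ true) (allFin n))
    where
    open import Data.Bool using () renaming (_≟_ to _≟ᵇ_)

  outdeg : Fin n → ℕ
  outdeg v = count (λ w → adj v w)

  indeg : Fin n → ℕ
  indeg v = count (λ u → adj u v)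

  isSink : Fin n → Bool
  isSink v = outdeg v ≡ᵇ 0
    where open import Data.Nat using (_≡ᵇ_)

  isSource : Fin n → Bool
  isSource v = indeg v ≡ᵇ 0
    where open import Data.Nat using (_≡ᵇ_)

  Sink : Fin n → Set
  Sink v = outdeg v ≡ 0

  Source : Fin n → Set
  Source v = indeg v ≡ 0

  data Walk : Fin n → Fin n → Set where
    here : ∀ {u} → Walk u u
    step : ∀ {u w v} → adj u w ≡ true → Walk w v → Walk u v

  HasDirectedCycle : Set
  HasDirectedCycle = ∃[ u ] ∃[ w ] (adj u w ≡ true × Walk w u)

  -- the player set P(u): players a with a directed walk from a to u
  InP : Fin n → Fin n → Set
  InP u a = Source a × Walk a u

record IsSET (G : Digraph) : Set where
  open Digraph G
  field
    uniqueSink  : ∃[ s ] (Sink G s × (∀ v → Sink G v → v ≡ s))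
    outdegOne   : ∀ v → ¬ Sink G v → outdeg G v ≡ 1
    acyclic     : ¬ HasDirectedCycle G
    indegNotOne : ∀ v → ¬ (indeg G v ≡ 1)

HasSize : ∀ {n} → (Fin n → Set) → ℕ → Set
HasSize {n} S k = Σ (List (Fin n)) λ l → Unique l × length l ≡ k × (∀ a → (a ∈ l ⇔ S a))

module _ (G : Digraph) where
  open Digraph G

  record Bracket : Set where
    field
      B        : Fin n → Fin n
      intoP    : ∀ v → Source G (B v)
      onPlayer : ∀ a → Source G a → B a ≡ a
      onMatch  : ∀ x → ¬ Source G x → ∃[ u ] (adj u x ≡ true × B x ≡ B u)

  open Bracket

  Distinct : Bracket → Bracket → Set
  Distinct b b' = ¬ (∀ v → B b v ≡ B b' v)

  module _ (R : RealField) where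
    open RealField R

    -- a scoring system: a value σ x for every vertex, required to be
    -- positive on matches; only its values on matches are ever used.
    record ScoringSystem : Set where
      field
        σ   : Fin n → Carrier
        pos : ∀ x → ¬ Source G x → 0# < σ x

    open ScoringSystem

    score : ScoringSystem → Bracket → Bracket → Carrier
    score s b b' = foldr add 0# (allFin n)
      where
      add : Fin n → Carrier → Carrier
      add x acc = if not (isSource G x) ∧ does (B b x ≟ B b' x)
                   then σ s x + acc else acc

    Resolving : ScoringSystem → List Bracket → Set
    Resolving s Bs = ∀ b b' → Distinct b b' →
      ∃[ bi ] (bi ∈ Bs × ¬ (score s bi b ≈ score s bi b'))

-- The lower bound max_{x ∈ M(T)} ( |P(x)| − max_{u ∈ N⁻(x)} |P(u)| ),
-- given the function p with p v = |P(v)|.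

module _ (G : Digraph) where
  open Digraph G

  maxList : List ℕ → ℕ
  maxList = foldr _⊔_ 0

  maxInP : (Fin n → ℕ) → Fin n → ℕ
  maxInP p x = maxList (map p (filter (λ u → adj u x ≟ᵇ true) (allFin n)))
    where open import Data.Bool using () renaming (_≟_ to _≟ᵇ_)

  bound : (Fin n → ℕ) → ℕ
  bound p = maxList (map (λ x → p x ∸ maxInP p x)
                         (filter (λ x → isSource G x ≟ᵇ false) (allFin n)))
    where open import Data.Bool using () renaming (_≟_ to _≟ᵇ_)

  numPlayers : ℕ
  numPlayers = count G (isSource G)

-- If x is a match with |P(x)| − max_u |P(u)| > |Bs|, counting gives two
-- players a and w of x, in different children of x, that no bracket of Bs sends
-- through x.  The bracket preferring a to w everywhere and the one preferring w to a
-- differ at x, but every bracket of Bs agrees with both or with neither at every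
-- vertex: they differ only where both a and w are present, which is above x, and a
-- bracket whose winner there is a or w sends that player through x.
--
-- Call a player light at a match z if it reaches z through a child other
-- than a heaviest one, so that at most the bound many players are light at z.  Label a
-- player by its position among the light players of the highest vertex at which it is
-- light; players light at a common vertex share that highest vertex, so their labels
-- differ.  Bracket i sends through each match the light player labelled i if there is
-- one and the heavy child's winner otherwise, so a player light at z wins z in the
-- bracket of its label.  With weights 2^k, a score determines the set of matches on which
-- two brackets agree.  Brackets b, b′ that all labelled brackets score equally then
-- agree everywhere, from the players up: at a match, either both winners come from the
-- heavy child, where b and b′ agree, or one of them is light and its bracket tells b and
-- b′ apart.

module Submission where

open import Defs
open import Data.Nat using (ℕ; _≤_)
open import Data.Fin using (Fin)
open import Data.List using (List; length)
open import Data.Product using (Σ; _×_)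
open import Relation.Binary.PropositionalEquality using (_≡_)

open import Algebra.Bundles using (CommutativeRing)
open import Algebra.Structures using (IsCommutativeRing)
open import Data.Bool using (Bool; true; false; not; _∧_; if_then_else_) renaming (_≟_ to _≟ᵇ_)
open import Data.Fin using (toℕ) renaming (_≟_ to _≟ᶠ_)
open import Data.Fin.Properties using (any?)
import Data.Fin as Fin
open import Data.List using ([]; _∷_; _++_; filter; foldr; map; allFin; tabulate; upTo)
open import Data.List.Properties
  using ( filter-none; foldr-cong; foldr-preservesᵒ
        ; length-++; length-map; length-removeAt′; length-tabulate; length-upTo )
open import Data.List.Membership.Propositional using (_∈_; _∉_; _─_; find)
open import Data.List.Membership.Propositional.Properties
  using ( ∈-allFin; ∈-filter⁺; ∈-filter⁻; ∈-map⁺; ∈-map⁻; ∈-++⁺ˡ; ∈-++⁺ʳ; ∈-++⁻; ∈-upTo⁺; ∈-length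
        ; foldr-selective )
open import Data.List.Relation.Binary.Subset.Propositional using (_⊆_)
import Data.List.Relation.Unary.All as ListAll
open ListAll using (All; all?)
open import Data.List.Relation.Unary.All.Properties using (¬All⇒Any¬)
open import Data.List.Relation.Unary.Any as Any using (here; there; index)
open import Data.List.Relation.Unary.Unique.Propositional using (Unique; []; _∷_)
open import Data.List.Relation.Unary.Unique.Propositional.Properties using (++⁺; filter⁺; allFin⁺)
open import Data.Nat using (zero; suc; _+_; _∸_; _^_; _<_; _⊔_; z≤n; s≤s; _≟_)
open import Data.Nat.Properties
  using ( ≤-refl; ≤-reflexive; ≤-trans; ≤-<-trans; <-≤-trans; ≤-pred; ≰⇒≥; ≮⇒≥; <⇒≱; <⇒≢
        ; <-cmp; m≤n⇒m<n∨m≡n; n≤0⇒n≡0; suc-injective; _≤?_; module ≤-Reasoning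
        ; m≤m+n; m≤n+m; +-monoʳ-≤; +-monoʳ-<; +-cancelˡ-≡; +-identityʳ
        ; m≤m⊔n; m≤n⊔m; ⊔-sel; m∸n≤m; m≤n⇒m∸n≡0; m≤o∸n⇒m+n≤o; m+n≤o⇒m≤o∸n; m^n>0 )
open import Data.Product using (_,_; proj₁; proj₂; ∃-syntax)
open import Data.Sum using (_⊎_; inj₁; inj₂; [_,_]′)
open import Data.Unit using (⊤)
open import Function using (_∘_)
open import Function.Bundles using (_⇔_; Equivalence; mk⇔)
import Induction.WellFounded as WF
open WF using (WfRec; Acc; acc; WellFounded)
open import Level using (0ℓ)
open import Relation.Binary using (Rel; DecidableEquality; tri<; tri≈; tri>)
open import Relation.Binary.Structures using (IsStrictTotalOrder)
open import Relation.Binary.PropositionalEquality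
  using (_≢_; refl; sym; trans; cong; cong₂; subst; module ≡-Reasoning)
open import Relation.Nullary using (¬_; Dec; yes; no; does; contradiction; ¬?; _×-dec_)
open import Relation.Nullary.Decidable using (map′; dec-true; dec-false; decidable-stable)
open import Relation.Unary using (Pred; Decidable; _⊆′_)

open Bracket

module _ {A : Set} where

  ∈-─⁺ : ∀ {x y} {ys : List A} (x∈ys : x ∈ ys) → y ∈ ys → y ≢ x → y ∈ ys ─ x∈ys
  ∈-─⁺ (here refl) (here refl) y≢x = contradiction refl y≢x
  ∈-─⁺ (here _)    (there y∈ys) _  = y∈ys
  ∈-─⁺ (there _)   (here refl)  _  = here refl
  ∈-─⁺ (there x∈ys) (there y∈ys) y≢x = there (∈-─⁺ x∈ys y∈ys y≢x)

  Unique-⊆⇒length≤ : ∀ {xs ys : List A} → Unique xs → xs ⊆ ys → length xs ≤ length ys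
  Unique-⊆⇒length≤ {[]} _ _ = z≤n
  Unique-⊆⇒length≤ {x ∷ xs} {ys} (x∉xs ∷ xs!) xs⊆ys = begin
      suc (length xs)          ≤⟨ s≤s (Unique-⊆⇒length≤ xs! xs⊆ys─x) ⟩
      suc (length (ys ─ x∈ys)) ≡⟨ length-removeAt′ ys (index x∈ys) ⟨
      length ys                ∎
    where
    open ≤-Reasoning
    x∈ys = xs⊆ys (here refl)
    xs⊆ys─x : xs ⊆ ys ─ x∈ys
    xs⊆ys─x y∈xs =
      ∈-─⁺ x∈ys (xs⊆ys (there y∈xs)) (λ y≡x → ListAll.lookup x∉xs y∈xs (sym y≡x))

  length≡1⇒∈-unique : ∀ {x y} {xs : List A} → length xs ≡ 1 → x ∈ xs → y ∈ xs → x ≡ y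
  length≡1⇒∈-unique {xs = _ ∷ []} _ (here refl) (here refl) = refl

module _ {A : Set} (_≟_ : DecidableEquality A) where
  open import Data.List.Membership.DecPropositional _≟_ using (_∈?_)

  ∃-∉ : ∀ {xs ys : List A} → Unique xs → length ys < length xs → ∃[ x ] (x ∈ xs × x ∉ ys)
  ∃-∉ {xs} {ys} xs! ys<xs with all? (_∈? ys) xs
  ... | yes xs⊆ys = contradiction (Unique-⊆⇒length≤ xs! (ListAll.lookup xs⊆ys)) (<⇒≱ ys<xs)
  ... | no xs⊈ys  = find (¬All⇒Any¬ (_∈? ys) xs xs⊈ys)

  indexOf : A → List A → ℕ
  indexOf x [] = 0
  indexOf x (y ∷ ys) with x ≟ y
  ... | yes _ = 0
  ... | no _  = suc (indexOf x ys)

  indexOf-< : ∀ {x xs} → x ∈ xs → indexOf x xs < length xs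
  indexOf-< {x} {y ∷ ys} x∈xs with x ≟ y
  ... | yes _ = s≤s z≤n
  indexOf-< (here x≡y)   | no x≢y = contradiction x≡y x≢y
  indexOf-< (there x∈ys) | no _   = s≤s (indexOf-< x∈ys)

  indexOf-injective : ∀ {x y xs} → x ∈ xs → y ∈ xs → indexOf x xs ≡ indexOf y xs → x ≡ y
  indexOf-injective {x} {y} {z ∷ zs} x∈xs y∈xs eq with x ≟ z | y ≟ z
  ... | yes x≡z | yes y≡z = trans x≡z (sym y≡z)
  ... | no x≢z  | no y≢z  =
    indexOf-injective (Any.tail x≢z x∈xs) (Any.tail y≢z y∈xs) (suc-injective eq)

module _ {A : Set} {P : Pred A 0ℓ} (P? : Decidable P) where

  length-filter≡0⇒¬ : ∀ {xs x} → length (filter P? xs) ≡ 0 → x ∈ xs → ¬ P x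
  length-filter≡0⇒¬ len≡0 x∈xs px = <⇒≢ (∈-length (∈-filter⁺ P? x∈xs px)) (sym len≡0)

  length-filter≡1⇒unique : ∀ {xs x y} → length (filter P? xs) ≡ 1 →
                           x ∈ xs → y ∈ xs → P x → P y → x ≡ y
  length-filter≡1⇒unique len≡1 x∈xs y∈xs px py =
    length≡1⇒∈-unique len≡1 (∈-filter⁺ P? x∈xs px) (∈-filter⁺ P? y∈xs py)

m∈xs⇒m≤foldr⊔ : ∀ {m xs} → m ∈ xs → m ≤ foldr _⊔_ 0 xs
m∈xs⇒m≤foldr⊔ m∈xs = foldr-preservesᵒ
  (λ a b → [ (λ m≤a → ≤-trans m≤a (m≤m⊔n a b)) , (λ m≤b → ≤-trans m≤b (m≤n⊔m a b)) ]′)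
  0 _ (inj₂ (Any.map (λ { refl → ≤-refl }) m∈xs))

foldr⊔-sel : ∀ xs → foldr _⊔_ 0 xs ≡ 0 ⊎ foldr _⊔_ 0 xs ∈ xs
foldr⊔-sel = foldr-selective ⊔-sel 0

m<o∸n⇒m+n<o : ∀ {m n o} → m < o ∸ n → m + n < o
m<o∸n⇒m+n<o {m} {n} {o} m<o∸n with n ≤? o
... | yes n≤o = m≤o∸n⇒m+n≤o (suc m) n≤o m<o∸n
... | no n≰o  = contradiction (subst (m <_) (m≤n⇒m∸n≡0 (≰⇒≥ n≰o)) m<o∸n) λ ()

module _ {P : Pred ℕ 0ℓ} (P? : Decidable P) where

  greatestBelow : ℕ → ℕ
  greatestBelow zero = 0
  greatestBelow (suc k) with P? (suc k)
  ... | yes _ = suc k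
  ... | no _  = greatestBelow k

  greatestBelow-spec : ∀ {t k} → t ≤ k → P t → t ≤ greatestBelow k × P (greatestBelow k)
  greatestBelow-spec {k = zero} z≤n pt = z≤n , pt
  greatestBelow-spec {t} {suc k} t≤k pt with P? (suc k)
  ... | yes pk = t≤k , pk
  ... | no ¬pk with m≤n⇒m<n∨m≡n t≤k
  ...   | inj₁ t<k  = greatestBelow-spec (≤-pred t<k) pt
  ...   | inj₂ refl = contradiction pt ¬pk

-- Superincreasing weights

module _ {A : Set} (w : A → ℕ) where

  subsetSum : (A → Bool) → List A → ℕ
  subsetSum β = foldr (λ x s → if β x then w x + s else s) 0

  totalWeight : List A → ℕ
  totalWeight = subsetSum (λ _ → true)

  Superincreasing : List A → Set
  Superincreasing []       = ⊤
  Superincreasing (x ∷ xs) = totalWeight xs < w x × Superincreasing xs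

  subsetSum≤totalWeight : ∀ β xs → subsetSum β xs ≤ totalWeight xs
  subsetSum≤totalWeight β [] = z≤n
  subsetSum≤totalWeight β (x ∷ xs) with β x
  ... | true  = +-monoʳ-≤ (w x) (subsetSum≤totalWeight β xs)
  ... | false = ≤-trans (subsetSum≤totalWeight β xs) (m≤n+m _ (w x))

  private
    heavier-than-rest : ∀ {y xs} β s → totalWeight xs < w y → w y + s ≢ subsetSum β xs
    heavier-than-rest {y} {xs} β s rest<y eq =
      <⇒≱ (≤-<-trans (subsetSum≤totalWeight β xs) rest<y) (≤-trans (m≤m+n (w y) s) (≤-reflexive eq))

    subsetSum-∷-injective : ∀ {β β′ y xs} → totalWeight xs < w y →
      subsetSum β (y ∷ xs) ≡ subsetSum β′ (y ∷ xs) →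
      β y ≡ β′ y × subsetSum β xs ≡ subsetSum β′ xs
    subsetSum-∷-injective {β} {β′} {y} {xs} rest<y eq with β y | β′ y
    ... | true  | true  = refl , +-cancelˡ-≡ (w y) _ _ eq
    ... | false | false = refl , eq
    ... | true  | false = contradiction eq (heavier-than-rest {y} {xs} β′ _ rest<y)
    ... | false | true  = contradiction (sym eq) (heavier-than-rest {y} {xs} β _ rest<y)

  subsetSum-injective : ∀ {β β′ xs} → Superincreasing xs → subsetSum β xs ≡ subsetSum β′ xs →
                        ∀ {x} → x ∈ xs → β x ≡ β′ x
  subsetSum-injective {β} {β′} {y ∷ xs} (rest<y , _) eq (here refl) =
    proj₁ (subsetSum-∷-injective {β} {β′} {y} {xs} rest<y eq)
  subsetSum-injective {β} {β′} {y ∷ xs} (rest<y , sup) eq (there x∈xs) =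
    subsetSum-injective sup (proj₂ (subsetSum-∷-injective {β} {β′} {y} {xs} rest<y eq)) x∈xs

  descendingPowers-superincreasing : ∀ m (g : Fin m → A) →
    (∀ i → w (g i) ≡ 2 ^ (m ∸ suc (toℕ i))) →
    Superincreasing (tabulate g) × totalWeight (tabulate g) < 2 ^ m
  descendingPowers-superincreasing zero g w≡ = _ , s≤s z≤n
  descendingPowers-superincreasing (suc m) g w≡
    with descendingPowers-superincreasing m (λ i → g (Fin.suc i)) (λ i → w≡ (Fin.suc i))
  ... | sup , rest<2^m = (subst (rest <_) (sym (w≡ Fin.zero)) rest<2^m , sup) , total<
    where
    rest = totalWeight (tabulate (λ i → g (Fin.suc i)))
    total< : w (g Fin.zero) + rest < 2 ^ suc m
    total< rewrite w≡ Fin.zero | +-identityʳ (2 ^ m) = +-monoʳ-< (2 ^ m) rest<2^m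

module RealFieldProperties (ℝ : RealField) where
  open RealField ℝ
    using (Carrier; _≈_; 0#; 1#; -_; 0≉1; +-mono-<; *-pos; isCommutativeRing; isStrictTotalOrder)
    renaming (_+_ to _+ℝ_; _*_ to _*ℝ_; _<_ to _<ℝ_)

  commutativeRing : CommutativeRing 0ℓ 0ℓ
  commutativeRing = record
    { Carrier = Carrier ; _≈_ = _≈_ ; _+_ = _+ℝ_ ; _*_ = _*ℝ_ ; -_ = -_ ; 0# = 0# ; 1# = 1#
    ; isCommutativeRing = isCommutativeRing }

  module R = CommutativeRing commutativeRing
  open IsStrictTotalOrder isStrictTotalOrder
    using (compare; irrefl; asym; <-respˡ-≈; <-respʳ-≈) renaming (trans to <-trans)
  open import Algebra.Properties.Ring R.ring using (-1*x≈-x; -‿involutive)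
  open import Algebra.Properties.Monoid.Mult R.+-monoid using (×-homo-+) renaming (_×_ to _·_)

  -- 0 < 1 is not an axiom: if 1 < 0 then 0 < -1, hence 0 < (-1) * (-1) ≈ 1.
  0<1 : 0# <ℝ 1#
  0<1 with compare 0# 1#
  ... | tri< 0<1 _ _ = 0<1
  ... | tri≈ _ 0≈1 _ = contradiction 0≈1 0≉1
  ... | tri> _ _ 1<0 = contradiction 0<1′ (asym 1<0)
    where
    0<-1 : 0# <ℝ - 1#
    0<-1 = <-respʳ-≈ (R.+-identityˡ (- 1#)) (<-respˡ-≈ (R.-‿inverseʳ 1#) (+-mono-< (- 1#) 1<0))
    0<1′ : 0# <ℝ 1#
    0<1′ = <-respʳ-≈ (R.trans (-1*x≈-x (- 1#)) (-‿involutive 1#)) (*-pos 0<-1 0<-1)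

  fromℕ : ℕ → Carrier
  fromℕ k = k · 1#

  fromℕ-+ : ∀ k l → fromℕ (k + l) ≈ fromℕ k +ℝ fromℕ l
  fromℕ-+ = ×-homo-+ 1#

  fromℕ<fromℕ-suc : ∀ k → fromℕ k <ℝ fromℕ (suc k)
  fromℕ<fromℕ-suc k = <-respˡ-≈ (R.+-identityˡ (fromℕ k)) (+-mono-< (fromℕ k) 0<1)

  fromℕ-<-mono : ∀ {k l} → k < l → fromℕ k <ℝ fromℕ l
  fromℕ-<-mono {k} {suc l} (s≤s k≤l) with m≤n⇒m<n∨m≡n k≤l
  ... | inj₁ k<l  = <-trans (fromℕ-<-mono k<l) (fromℕ<fromℕ-suc l)
  ... | inj₂ refl = fromℕ<fromℕ-suc k

  fromℕ-injective : ∀ {k l} → fromℕ k ≈ fromℕ l → k ≡ l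
  fromℕ-injective {k} {l} k≈l with <-cmp k l
  ... | tri< k<l _ _ = contradiction (fromℕ-<-mono k<l) (irrefl k≈l)
  ... | tri≈ _ k≡l _ = k≡l
  ... | tri> _ _ l<k = contradiction (fromℕ-<-mono l<k) (irrefl (R.sym k≈l))

  module _ {A : Set} (w : A → ℕ) where

    fromℕ-subsetSum : ∀ (β : A → Bool) xs →
      foldr (λ x acc → if β x then fromℕ (w x) +ℝ acc else acc) 0# xs ≈ fromℕ (subsetSum w β xs)
    fromℕ-subsetSum β [] = R.refl
    fromℕ-subsetSum β (x ∷ xs) with β x
    ... | true  = R.trans (R.+-cong R.refl (fromℕ-subsetSum β xs)) (R.sym (fromℕ-+ (w x) (subsetSum w β xs)))
    ... | false = fromℕ-subsetSum β xs

module Tournament (T : Digraph) (isSET : IsSET T) where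
  open Digraph T
  open IsSET isSET

  infix 4 _↝_
  _↝_ : Rel (Fin n) 0ℓ
  u ↝ v = adj u v ≡ true

  source⇒¬↝ : ∀ {u x} → Source T x → ¬ u ↝ x
  source⇒¬↝ {u} {x} s = length-filter≡0⇒¬ (λ v → adj v x ≟ᵇ true) s (∈-allFin u)

  ¬↝⇒source : ∀ {x} → (∀ u → ¬ u ↝ x) → Source T x
  ¬↝⇒source {x} none =
    cong length (filter-none (λ v → adj v x ≟ᵇ true) {allFin n} (ListAll.tabulate (λ {u} _ → none u)))

  source? : Decidable (Source T)
  source? x = indeg T x ≟ 0

  isSource-false : ∀ {x} → ¬ Source T x → isSource T x ≡ false
  isSource-false {x} = dec-false (source? x)

  ↝-functional : ∀ {v w w′} → v ↝ w → v ↝ w′ → w ≡ w′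
  ↝-functional {v} {w} {w′} e e′ = length-filter≡1⇒unique (λ u → adj v u ≟ᵇ true)
    (outdegOne v (λ sink → length-filter≡0⇒¬ (λ u → adj v u ≟ᵇ true) sink (∈-allFin w) e))
    (∈-allFin w) (∈-allFin w′) e e′

  someChild : Fin n → Fin n
  someChild x with any? (λ u → adj u x ≟ᵇ true)
  ... | yes (u , _) = u
  ... | no _        = x

  someChild-↝ : ∀ {x} → ¬ Source T x → someChild x ↝ x
  someChild-↝ {x} ns with any? (λ u → adj u x ≟ᵇ true)
  ... | yes (_ , e) = e
  ... | no none     = contradiction (¬↝⇒source (λ u e → none (u , e))) ns

  next : Fin n → Fin n
  next v with any? (λ w → adj v w ≟ᵇ true)
  ... | yes (w , _) = w
  ... | no _        = v

  ↝⇒next : ∀ {v w} → v ↝ w → next v ≡ w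
  ↝⇒next {v} e with any? (λ w → adj v w ≟ᵇ true)
  ... | yes (_ , e′) = ↝-functional e′ e
  ... | no none      = contradiction (_ , e) none

  next-spec : ∀ v → next v ≡ v ⊎ v ↝ next v
  next-spec v with any? (λ w → adj v w ≟ᵇ true)
  ... | yes (_ , e) = inj₂ e
  ... | no _        = inj₁ refl

  infixl 5 _▷_
  _▷_ : ∀ {a u v} → Walk T a u → u ↝ v → Walk T a v
  here       ▷ e = step e here
  step e′ w  ▷ e = step e′ (w ▷ e)

  infixr 5 _◅◅_
  _◅◅_ : ∀ {a u v} → Walk T a u → Walk T u v → Walk T a v
  here     ◅◅ w′ = w′
  step e w ◅◅ w′ = step e (w ◅◅ w′)

  walkLength : ∀ {u v} → Walk T u v → ℕ
  walkLength here       = 0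
  walkLength (step _ w) = suc (walkLength w)

  walkLength-▷ : ∀ {a u v} (w : Walk T a u) (e : u ↝ v) → walkLength (w ▷ e) ≡ suc (walkLength w)
  walkLength-▷ here        e = refl
  walkLength-▷ (step _ w)  e = cong suc (walkLength-▷ w e)

  walk-antisym : ∀ {u v} → Walk T u v → Walk T v u → u ≡ v
  walk-antisym here       _  = refl
  walk-antisym (step e w) w′ = contradiction (_ , _ , e , w ◅◅ w′) acyclic

  walk-comparable : ∀ {a u v} → Walk T a u → Walk T a v → Walk T u v ⊎ Walk T v u
  walk-comparable here          w′            = inj₁ w′
  walk-comparable w@(step _ _)  here          = inj₂ w
  walk-comparable (step e w)    (step e′ w′) with ↝-functional e e′
  ... | refl = walk-comparable w w′

  walk-unsnoc : ∀ {a v} → Walk T a v → a ≡ v ⊎ ∃[ u ] (Walk T a u × u ↝ v)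
  walk-unsnoc here = inj₁ refl
  walk-unsnoc (step e w) with walk-unsnoc w
  ... | inj₁ refl            = inj₂ (_ , here , e)
  ... | inj₂ (u , w′ , e′)   = inj₂ (u , step e w′ , e′)

  private
    departures : ∀ {u v} → Walk T u v → List (Fin n)
    departures here               = []
    departures (step {u = u} _ w) = u ∷ departures w

    length-departures : ∀ {u v} (w : Walk T u v) → length (departures w) ≡ walkLength w
    length-departures here       = refl
    length-departures (step _ w) = cong suc (length-departures w)

    ∈-departures⇒walk : ∀ {u v x} (w : Walk T u v) → x ∈ departures w → Walk T u x
    ∈-departures⇒walk (step e w) (here refl) = here
    ∈-departures⇒walk (step e w) (there x∈) = step e (∈-departures⇒walk w x∈)

    departures-unique : ∀ {u v} (w : Walk T u v) → Unique (departures w)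
    departures-unique here       = []
    departures-unique (step e w) =
      ListAll.tabulate (λ x∈ u≡x →
        acyclic (_ , _ , e , subst (Walk T _) (sym u≡x) (∈-departures⇒walk w x∈)))
      ∷ departures-unique w

  walkLength≤n : ∀ {u v} (w : Walk T u v) → walkLength w ≤ n
  walkLength≤n w = begin
    walkLength w             ≡⟨ length-departures w ⟨
    length (departures w)    ≤⟨ Unique-⊆⇒length≤ (departures-unique w) (λ {x} _ → ∈-allFin x) ⟩
    length (allFin n)        ≡⟨ length-tabulate (λ x → x) ⟩
    n                        ∎
    where open ≤-Reasoning

  private
    acc-if-walks-≤ : ∀ m {x} → (∀ {y} (w : Walk T y x) → walkLength w ≤ m) → Acc _↝_ x
    acc-if-walks-≤ zero    walks-≤ = acc λ e → contradiction (walks-≤ (step e here)) λ ()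
    acc-if-walks-≤ (suc m) walks-≤ = acc λ e →
      acc-if-walks-≤ m λ w → ≤-pred (subst (_≤ suc m) (walkLength-▷ w e) (walks-≤ (w ▷ e)))

  ↝-wellFounded : WellFounded _↝_
  ↝-wellFounded x = acc-if-walks-≤ n walkLength≤n

  open WF.All ↝-wellFounded 0ℓ public using () renaming (wfRec to ↝-rec)

  climb : ℕ → Fin n → Fin n
  climb zero    v = v
  climb (suc t) v = climb t (next v)

  walk⇒climb : ∀ {a v} (w : Walk T a v) → climb (walkLength w) a ≡ v
  walk⇒climb here       = refl
  walk⇒climb (step e w) rewrite ↝⇒next e = walk⇒climb w

  walk-next : ∀ v → Walk T v (next v)
  walk-next v with next-spec v
  ... | inj₁ next≡v = subst (Walk T v) (sym next≡v) here
  ... | inj₂ e      = step e here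

  walk-climb : ∀ t v → Walk T v (climb t v)
  walk-climb zero    v = here
  walk-climb (suc t) v = walk-next v ◅◅ walk-climb t (next v)

  climb-mono : ∀ {s t} → s ≤ t → ∀ v → Walk T (climb s v) (climb t v)
  climb-mono {t = t} z≤n v = walk-climb t v
  climb-mono (s≤s s≤t) v = climb-mono s≤t (next v)

  InP-mono : ∀ {u v a} → Walk T u v → InP T u a → InP T v a
  InP-mono w (s , wa) = s , wa ◅◅ w

  source-InP : ∀ {a b} → Source T a → InP T a b → b ≡ a
  source-InP s (_ , w) with walk-unsnoc w
  ... | inj₁ b≡a        = b≡a
  ... | inj₂ (_ , _ , e) = contradiction e (source⇒¬↝ s)

  InP-child : ∀ {x a} → ¬ Source T x → InP T x a → ∃[ u ] (u ↝ x × InP T u a)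
  InP-child ns (s , w) with walk-unsnoc w
  ... | inj₁ refl         = contradiction s ns
  ... | inj₂ (u , w′ , e) = u , e , s , w′

  private
    reach-sibling : ∀ {u₁ u₂ x} → u₁ ↝ x → u₂ ↝ x → Walk T u₁ u₂ → u₁ ≡ u₂
    reach-sibling _  _  here       = refl
    reach-sibling e₁ e₂ (step e w) with ↝-functional e e₁
    ... | refl = contradiction (_ , _ , e₂ , w) acyclic

  child-unique : ∀ {u₁ u₂ x a} → u₁ ↝ x → u₂ ↝ x → InP T u₁ a → InP T u₂ a → u₁ ≡ u₂
  child-unique e₁ e₂ (_ , w₁) (_ , w₂) with walk-comparable w₁ w₂
  ... | inj₁ w = reach-sibling e₁ e₂ w
  ... | inj₂ w = sym (reach-sibling e₂ e₁ w)

  enter-same-child : ∀ {y z a b c} → Walk T y z → InP T y a → InP T y b →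
                     c ↝ z → InP T c a → y ≡ z ⊎ InP T c b
  enter-same-child wyz ya yb c↝z ca with walk-unsnoc wyz
  ... | inj₁ y≡z = inj₁ y≡z
  ... | inj₂ (u , wyu , u↝z) with child-unique u↝z c↝z (InP-mono wyu ya) ca
  ...   | refl = inj₂ (InP-mono wyu yb)

  meet-above : ∀ {x u z a w} → InP T x a → u ↝ x → InP T u a → ¬ InP T u w →
               InP T z a → InP T z w → Walk T x z
  meet-above (_ , ax) u↝x ua ¬uw za@(_ , az) zw with walk-comparable ax az
  ... | inj₁ xz = xz
  ... | inj₂ zx with enter-same-child zx za zw u↝x ua
  ...   | inj₁ refl = here
  ...   | inj₂ uw   = contradiction uw ¬uw

  module _ (b : Bracket T) where

    bracket-walk : ∀ v → Walk T (B b v) v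
    bracket-walk = ↝-rec _ go
      where
      go : ∀ v → (∀ {u} → u ↝ v → Walk T (B b u) u) → Walk T (B b v) v
      go v rec with source? v
      ... | yes s = subst (λ y → Walk T y v) (sym (onPlayer b v s)) here
      ... | no ns with onMatch b v ns
      ...   | u , e , Bv≡Bu = subst (λ y → Walk T y v) (sym Bv≡Bu) (rec e ▷ e)

    B-InP : ∀ v → InP T v (B b v)
    B-InP v = intoP b v , bracket-walk v

    winner-step : ∀ {u y} → u ↝ y → InP T u (B b y) → B b u ≡ B b y
    winner-step e uBy with onMatch b _ (λ s → source⇒¬↝ s e)
    ... | u′ , e′ , By≡Bu′ with child-unique e′ e (subst (InP T u′) (sym By≡Bu′) (B-InP u′)) uBy
    ...   | refl = sym By≡Bu′

    winner-below : ∀ {x y} → Walk T x y → InP T x (B b y) → B b x ≡ B b y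
    winner-below here       _   = refl
    winner-below (step e w) xBy = trans (winner-step e (subst (InP T _) (sym Bx′≡By) xBy)) Bx′≡By
      where Bx′≡By = winner-below w (InP-mono (step e here) xBy)

  module Selection (sel : Fin n → Fin n) (sel↝ : ∀ {x} → ¬ Source T x → sel x ↝ x) where
    private
      Winner : Fin n → Set
      Winner _ = Fin n

      play : WfRec _↝_ Winner ⊆′ Winner
      play x rec with source? x
      ... | yes _ = x
      ... | no ns = rec (sel↝ ns)

      play-ext : ∀ x {rec rec′ : WfRec _↝_ Winner x} →
                 (∀ {u} (u↝x : u ↝ x) → rec u↝x ≡ rec′ u↝x) → play x rec ≡ play x rec′
      play-ext x rec≡rec′ with source? x
      ... | yes _ = refl
      ... | no ns = rec≡rec′ (sel↝ ns)

      open WF.FixPoint ↝-wellFounded Winner play play-ext using (unfold-wfRec)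

    winner : Fin n → Fin n
    winner = ↝-rec Winner play

    winner-source : ∀ {x} → Source T x → winner x ≡ x
    winner-source {x} s rewrite unfold-wfRec {x} with source? x
    ... | yes _ = refl
    ... | no ns = contradiction s ns

    winner-match : ∀ {x} → ¬ Source T x → winner x ≡ winner (sel x)
    winner-match {x} ns rewrite unfold-wfRec {x} with source? x
    ... | yes s = contradiction s ns
    ... | no _  = refl

    winner-source-valued : ∀ x → Source T (winner x)
    winner-source-valued = ↝-rec (λ x → Source T (winner x)) go
      where
      go : ∀ x → (∀ {u} → u ↝ x → Source T (winner u)) → Source T (winner x)
      go x rec = by-cases (source? x)
        where
        -- Matching on the decision in a helper instead of a `with` keeps `winner` folded.
        by-cases : Dec (Source T x) → Source T (winner x)
        by-cases (yes s) = subst (Source T) (sym (winner-source s)) s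
        by-cases (no ns) = subst (Source T) (sym (winner-match ns)) (rec (sel↝ ns))

    bracket : Bracket T
    bracket = record
      { B        = winner
      ; intoP    = winner-source-valued
      ; onPlayer = λ _ → winner-source
      ; onMatch  = λ x ns → sel x , sel↝ ns , winner-match ns
      }

    winner-follows : ∀ {x a} → InP T x a →
                     (∀ {v} → ¬ Source T v → Walk T v x → InP T v a → InP T (sel v) a) →
                     winner x ≡ a
    winner-follows {x} {a} xa follows = ↝-rec Wins go x here xa
      where
      Wins : Fin n → Set
      Wins v = Walk T v x → InP T v a → winner v ≡ a
      go : ∀ v → (∀ {u} → u ↝ v → Wins u) → Wins v
      go v rec vx va = by-cases (source? v)
        where
        by-cases : Dec (Source T v) → winner v ≡ a
        by-cases (yes s) = trans (winner-source s) (sym (source-InP s va))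
        by-cases (no ns) = trans (winner-match ns) (rec (sel↝ ns) (step (sel↝ ns) vx) (follows ns vx va))

  selection-agree : ∀ {sel sel′} (sel↝ : ∀ {x} → ¬ Source T x → sel x ↝ x)
                    (sel′↝ : ∀ {x} → ¬ Source T x → sel′ x ↝ x) {x} →
                    (∀ {v} → ¬ Source T v → Walk T v x → sel v ≡ sel′ v) →
                    Selection.winner sel sel↝ x ≡ Selection.winner sel′ sel′↝ x
  selection-agree {sel} {sel′} sel↝ sel′↝ {x} agree = ↝-rec Agree go x here
    where
    open Selection sel sel↝
    open Selection sel′ sel′↝ using ()
      renaming (winner to winner′; winner-source to winner′-source; winner-match to winner′-match)
    Agree : Fin n → Set
    Agree v = Walk T v x → winner v ≡ winner′ v
    go : ∀ v → (∀ {u} → u ↝ v → Agree u) → Agree v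
    go v rec vx = by-cases (source? v)
      where
      by-cases : Dec (Source T v) → winner v ≡ winner′ v
      by-cases (yes s) = trans (winner-source s) (sym (winner′-source s))
      by-cases (no ns) = begin
        winner v          ≡⟨ winner-match ns ⟩
        winner (sel v)    ≡⟨ rec (sel↝ ns) (step (sel↝ ns) vx) ⟩
        winner′ (sel v)   ≡⟨ cong winner′ (agree ns vx) ⟩
        winner′ (sel′ v)  ≡⟨ winner′-match ns ⟨
        winner′ v         ∎
        where open ≡-Reasoning

  AgreesEqually : Bracket T → Bracket T → Bracket T → Set
  AgreesEqually b c d = ∀ x → (B b x ≡ B c x) ⇔ (B b x ≡ B d x)

  score-cong : ∀ (ℝ : RealField) (σ : ScoringSystem T ℝ) {b c d} →
               AgreesEqually b c d → score T ℝ σ b c ≡ score T ℝ σ b d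
  score-cong ℝ σ {b} {c} {d} agrees =
    foldr-cong (λ x acc → cong (λ bit → if not (isSource T x) ∧ bit then σ′ x +ℝ acc else acc) (bits x))
               refl (allFin n)
    where
    open RealField ℝ using () renaming (_+_ to _+ℝ_)
    σ′ = ScoringSystem.σ σ
    bits : ∀ x → does (B b x ≟ᶠ B c x) ≡ does (B b x ≟ᶠ B d x)
    bits x with B b x ≟ᶠ B c x
    ... | yes bc = sym (dec-true (B b x ≟ᶠ B d x) (Equivalence.to (agrees x) bc))
    ... | no ¬bc = sym (dec-false (B b x ≟ᶠ B d x) (¬bc ∘ Equivalence.from (agrees x)))

  module PlayerCounts (p : Fin n → ℕ) (hasSize : ∀ v → HasSize (InP T v) (p v)) where

    players : Fin n → List (Fin n)
    players v = proj₁ (hasSize v)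

    players-unique : ∀ v → Unique (players v)
    players-unique v = proj₁ (proj₂ (hasSize v))

    length-players : ∀ v → length (players v) ≡ p v
    length-players v = proj₁ (proj₂ (proj₂ (hasSize v)))

    ∈-players⁻ : ∀ {v a} → a ∈ players v → InP T v a
    ∈-players⁻ {v} {a} = Equivalence.to (proj₂ (proj₂ (proj₂ (hasSize v))) a)

    ∈-players⁺ : ∀ {v a} → InP T v a → a ∈ players v
    ∈-players⁺ {v} {a} = Equivalence.from (proj₂ (proj₂ (proj₂ (hasSize v))) a)

    InP? : ∀ v → Decidable (InP T v)
    InP? v a = map′ ∈-players⁻ ∈-players⁺ (a ∈? players v)
      where open import Data.List.Membership.DecPropositional (_≟ᶠ_ {n}) using (_∈?_)

    childContaining : Fin n → Fin n → Fin n
    childContaining x a with any? (λ u → (adj u x ≟ᵇ true) ×-dec InP? u a)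
    ... | yes (u , _) = u
    ... | no _        = someChild x

    childContaining-↝ : ∀ {x} a → ¬ Source T x → childContaining x a ↝ x
    childContaining-↝ {x} a ns with any? (λ u → (adj u x ≟ᵇ true) ×-dec InP? u a)
    ... | yes (_ , e , _) = e
    ... | no _            = someChild-↝ ns

    childContaining-InP : ∀ {x a} → ¬ Source T x → InP T x a → InP T (childContaining x a) a
    childContaining-InP {x} {a} ns xa with any? (λ u → (adj u x ≟ᵇ true) ×-dec InP? u a)
    ... | yes (_ , _ , ua) = ua
    ... | no none          = contradiction (InP-child ns xa) none

    children : Fin n → List (Fin n)
    children x = filter (λ u → adj u x ≟ᵇ true) (allFin n)

    p≤maxInP : ∀ {u x} → u ↝ x → p u ≤ maxInP T p x
    p≤maxInP {u} {x} e = m∈xs⇒m≤foldr⊔ (∈-map⁺ p (∈-filter⁺ (λ u → adj u x ≟ᵇ true) (∈-allFin u) e))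

    maxInP-attained : ∀ {x} → ¬ Source T x → ∃[ u ] (u ↝ x × p u ≡ maxInP T p x)
    maxInP-attained {x} ns with foldr⊔-sel (map p (children x))
    ... | inj₁ max≡0 = someChild x , someChild-↝ ns ,
      trans (n≤0⇒n≡0 (subst (p (someChild x) ≤_) max≡0 (p≤maxInP (someChild-↝ ns)))) (sym max≡0)
    ... | inj₂ max∈ with ∈-map⁻ p max∈
    ...   | u , u∈ , max≡pu =
      u , proj₂ (∈-filter⁻ (λ u → adj u x ≟ᵇ true) {xs = allFin n} u∈) , sym max≡pu

    gap : Fin n → ℕ
    gap x = p x ∸ maxInP T p x

    gap≤bound : ∀ {x} → ¬ Source T x → gap x ≤ bound T p
    gap≤bound {x} ns = m∈xs⇒m≤foldr⊔
      (∈-map⁺ gap (∈-filter⁺ (λ x → isSource T x ≟ᵇ false) (∈-allFin x) (isSource-false ns)))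

    bound-attained : ∀ {l} → l < bound T p → ∃[ x ] (¬ Source T x × l < gap x)
    bound-attained {l} l<bound with foldr⊔-sel (map gap (filter (λ x → isSource T x ≟ᵇ false) (allFin n)))
    ... | inj₁ bound≡0 = contradiction (subst (l <_) bound≡0 l<bound) λ ()
    ... | inj₂ bound∈ with ∈-map⁻ gap bound∈
    ...   | x , x∈ , bound≡gap = x , is-match , subst (l <_) bound≡gap l<bound
      where
      is-match : ¬ Source T x
      is-match s = contradiction (trans (sym (dec-true (source? x) s)) isSource≡false) λ ()
        where isSource≡false = proj₂ (∈-filter⁻ (λ x → isSource T x ≟ᵇ false) {xs = allFin n} x∈)

    -- Lower bound

    InP-outside : ∀ x {ys} → length ys < p x → ∃[ a ] (InP T x a × a ∉ ys)
    InP-outside x {ys} ys<p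
      with ∃-∉ _≟ᶠ_ (players-unique x) (subst (length ys <_) (sym (length-players x)) ys<p)
    ... | a , a∈ , a∉ = a , ∈-players⁻ a∈ , a∉

    prefer : Fin n → Fin n → Fin n → Fin n
    prefer a w z with InP? z a | InP? z w
    ... | yes _ | _     = childContaining z a
    ... | no _  | yes _ = childContaining z w
    ... | no _  | no _  = someChild z

    prefer-↝ : ∀ a w {z} → ¬ Source T z → prefer a w z ↝ z
    prefer-↝ a w {z} ns with InP? z a | InP? z w
    ... | yes _ | _     = childContaining-↝ a ns
    ... | no _  | yes _ = childContaining-↝ w ns
    ... | no _  | no _  = someChild-↝ ns

    module Prefer (a w : Fin n) = Selection (prefer a w) (prefer-↝ a w)

    prefer-first : ∀ {a w z} → InP T z a → Prefer.winner a w z ≡ a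
    prefer-first {a} {w} za = Prefer.winner-follows a w za follows
      where
      follows : ∀ {v} → ¬ Source T v → Walk T v _ → InP T v a → InP T (prefer a w v) a
      follows {v} ns _ va with InP? v a | InP? v w
      ... | yes _  | _ = childContaining-InP ns va
      ... | no ¬va | _ = contradiction va ¬va

    prefer-swap : ∀ {a w z} → ¬ (InP T z a × InP T z w) → Prefer.winner a w z ≡ Prefer.winner w a z
    prefer-swap {a} {w} ¬both = selection-agree (prefer-↝ a w) (prefer-↝ w a) swap
      where
      swap : ∀ {v} → ¬ Source T v → Walk T v _ → prefer a w v ≡ prefer w a v
      swap {v} _ vz with InP? v a | InP? v w
      ... | yes va | yes vw = contradiction (InP-mono vz va , InP-mono vz vw) ¬both
      ... | yes _  | no _   = refl
      ... | no _   | yes _  = refl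
      ... | no _   | no _   = refl

    winnersAt : List (Bracket T) → Fin n → List (Fin n)
    winnersAt Bs x = map (λ b → B b x) Bs

    unpicked-pair : ∀ (Bs : List (Bracket T)) {x} → ¬ Source T x → length Bs < gap x →
      ∃[ a ] ∃[ w ] (InP T x a × InP T x w × a ∉ winnersAt Bs x × w ∉ winnersAt Bs x ×
                     ¬ InP T (childContaining x a) w)
    unpicked-pair Bs {x} ns L<gap = pick-second (InP-outside x winners<p)
      where
      winners = winnersAt Bs x

      winners<p : length winners < p x
      winners<p = begin-strict
        length winners  ≡⟨ length-map _ Bs ⟩
        length Bs       <⟨ L<gap ⟩
        gap x           ≤⟨ m∸n≤m (p x) (maxInP T p x) ⟩
        p x             ∎
        where open ≤-Reasoning

      winners++<p : ∀ a → length (winners ++ players (childContaining x a)) < p x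
      winners++<p a = begin-strict
        length (winners ++ players u)        ≡⟨ length-++ winners ⟩
        length winners + length (players u)  ≡⟨ cong₂ _+_ (length-map _ Bs) (length-players u) ⟩
        length Bs + p u                      ≤⟨ +-monoʳ-≤ (length Bs) (p≤maxInP (childContaining-↝ a ns)) ⟩
        length Bs + maxInP T p x             <⟨ m<o∸n⇒m+n<o L<gap ⟩
        p x                                  ∎
        where
        open ≤-Reasoning
        u = childContaining x a

      pick-second : ∃[ a ] (InP T x a × a ∉ winners) →
                    ∃[ a ] ∃[ w ] (InP T x a × InP T x w × a ∉ winners × w ∉ winners ×
                                   ¬ InP T (childContaining x a) w)
      pick-second (a , xa , a∉) with InP-outside x (winners++<p a)
      ... | w , xw , w∉ = a , w , xa , xw , a∉ , w∉ ∘ ∈-++⁺ˡ , w∉ ∘ ∈-++⁺ʳ winners ∘ ∈-players⁺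

    unresolvable-pair : ∀ (Bs : List (Bracket T)) {x a w} → ¬ Source T x → InP T x a → InP T x w →
      a ∉ winnersAt Bs x → w ∉ winnersAt Bs x → ¬ InP T (childContaining x a) w →
      ∃[ C ] ∃[ D ] (Distinct T C D × (∀ {bi} → bi ∈ Bs → AgreesEqually bi C D))
    unresolvable-pair Bs {x} {a} {w} ns xa xw a∉ w∉ ¬uw =
      Prefer.bracket a w , Prefer.bracket w a , distinct , agrees
      where
      u = childContaining x a
      ua = childContaining-InP ns xa

      distinct : Distinct T (Prefer.bracket a w) (Prefer.bracket w a)
      distinct same = ¬uw (subst (InP T u) (trans (sym (prefer-first xa)) (trans (same x) (prefer-first xw))) ua)

      never-wins-above : ∀ {c bi z} → InP T x c → c ∉ winnersAt Bs x → bi ∈ Bs → Walk T x z → B bi z ≢ c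
      never-wins-above {bi = bi} xc c∉ bi∈ xz Bz≡c =
        c∉ (subst (_∈ winnersAt Bs x) (trans (winner-below bi xz (subst (InP T x) (sym Bz≡c) xc)) Bz≡c)
                  (∈-map⁺ (λ b → B b x) bi∈))

      agrees : ∀ {bi} → bi ∈ Bs → AgreesEqually bi (Prefer.bracket a w) (Prefer.bracket w a)
      agrees {bi} bi∈ z with InP? z a ×-dec InP? z w
      ... | no ¬both = mk⇔ (λ e → trans e C≡D) (λ e → trans e (sym C≡D))
        where C≡D = prefer-swap ¬both
      ... | yes (za , zw) = mk⇔ (λ e → contradiction (trans e (prefer-first za)) (never-wins-above xa a∉ bi∈ xz))
                                (λ e → contradiction (trans e (prefer-first zw)) (never-wins-above xw w∉ bi∈ xz))
        where xz = meet-above xa (childContaining-↝ a ns) ua ¬uw za zw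

    lower-bound : ∀ (ℝ : RealField) (σ : ScoringSystem T ℝ) (Bs : List (Bracket T)) →
                  Resolving T ℝ σ Bs → bound T p ≤ length Bs
    lower-bound ℝ σ Bs resolving = ≮⇒≥ {length Bs} λ L<bound →
      let x , ns , L<gap                  = bound-attained L<bound
          a , w , xa , xw , a∉ , w∉ , ¬uw = unpicked-pair Bs ns L<gap
          C , D , C≢D , agree             = unresolvable-pair Bs ns xa xw a∉ w∉ ¬uw
          bi , bi∈Bs , separates          = resolving C D C≢D
      in separates (reflexive (score-cong ℝ σ {bi} {C} {D} (agree bi∈Bs)))
      where open IsCommutativeRing (RealField.isCommutativeRing ℝ) using (reflexive)

    -- Upper bound

    heavy : Fin n → Fin n
    heavy x with source? x
    ... | yes _ = x
    ... | no ns = proj₁ (maxInP-attained ns)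

    heavy-spec : ∀ {x} → ¬ Source T x → heavy x ↝ x × p (heavy x) ≡ maxInP T p x
    heavy-spec {x} ns with source? x
    ... | yes s  = contradiction s ns
    ... | no ns′ = proj₂ (maxInP-attained ns′)

    Light : Fin n → Fin n → Set
    Light z a = ¬ Source T z × InP T z a × ¬ InP T (heavy z) a

    Light? : ∀ z → Decidable (Light z)
    Light? z a = ¬? (source? z) ×-dec InP? z a ×-dec ¬? (InP? (heavy z) a)

    lightPlayers : Fin n → List (Fin n)
    lightPlayers z = filter (Light? z) (allFin n)

    ∈-lightPlayers⁺ : ∀ {z a} → Light z a → a ∈ lightPlayers z
    ∈-lightPlayers⁺ {z} {a} = ∈-filter⁺ (Light? z) (∈-allFin a)

    ∈-lightPlayers⁻ : ∀ {z a} → a ∈ lightPlayers z → Light z a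
    ∈-lightPlayers⁻ {z} a∈ = proj₂ (∈-filter⁻ (Light? z) {xs = allFin n} a∈)

    length-lightPlayers≤bound : ∀ {z} → ¬ Source T z → length (lightPlayers z) ≤ bound T p
    length-lightPlayers≤bound {z} ns = ≤-trans (m+n≤o⇒m≤o∸n _ light+heavy≤p) (gap≤bound ns)
      where
      light = lightPlayers z
      h = heavy z
      light+heavy≤p : length light + maxInP T p z ≤ p z
      light+heavy≤p = begin
        length light + maxInP T p z          ≡⟨ cong (length light +_) (sym (proj₂ (heavy-spec ns))) ⟩
        length light + p h                   ≡⟨ cong (length light +_) (length-players h) ⟨
        length light + length (players h)    ≡⟨ length-++ light ⟨
        length (light ++ players h)          ≤⟨ Unique-⊆⇒length≤ unique ⊆players ⟩
        length (players z)                   ≡⟨ length-players z ⟩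
        p z                                  ∎
        where
        open ≤-Reasoning
        unique = ++⁺ (filter⁺ (Light? z) (allFin⁺ n)) (players-unique h)
                     (λ (l∈ , h∈) → proj₂ (proj₂ (∈-lightPlayers⁻ l∈)) (∈-players⁻ h∈))
        ⊆players : light ++ players h ⊆ players z
        ⊆players a∈ with ∈-++⁻ light a∈
        ... | inj₁ l∈ = ∈-players⁺ (proj₁ (proj₂ (∈-lightPlayers⁻ l∈)))
        ... | inj₂ h∈ = ∈-players⁺ (InP-mono (step (proj₁ (heavy-spec ns)) here) (∈-players⁻ h∈))

    light-transfer : ∀ {y z a b} → InP T y a → Light y b → Walk T y z → Light z a → Light z b
    light-transfer ya (_ , yb , ¬hb) yz (nsz , _ , ¬ha) = nsz , InP-mono yz yb , ¬hb′
      where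
      ¬hb′ : ¬ InP T (heavy _) _
      ¬hb′ hb with enter-same-child yz yb ya (proj₁ (heavy-spec nsz)) hb
      ... | inj₁ refl = ¬hb hb
      ... | inj₂ ha   = ¬ha ha

    -- The highest vertex on the path from a to the sink at which a is light (junk if none).
    top : Fin n → Fin n
    top a = climb (greatestBelow (λ t → Light? (climb t a) a) n) a

    top-spec : ∀ {y a} → Light y a → Light (top a) a × Walk T y (top a)
    top-spec {y} {a} ya@(_ , (_ , ay) , _) =
      proj₂ spec , subst (λ v → Walk T v (top a)) (walk⇒climb ay) (climb-mono (proj₁ spec) a)
      where
      spec = greatestBelow-spec (λ t → Light? (climb t a) a) (walkLength≤n ay)
               (subst (λ v → Light v a) (sym (walk⇒climb ay)) ya)

    top-shared : ∀ {y a b} → Light y a → Light y b → top a ≡ top b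
    top-shared ya yb = walk-antisym (top-reaches ya yb) (top-reaches yb ya)
      where
      top-reaches : ∀ {y a b} → Light y a → Light y b → Walk T (top a) (top b)
      top-reaches ya@(_ , ya′ , _) yb =
        proj₂ (top-spec (light-transfer ya′ yb (proj₂ (top-spec ya)) (proj₁ (top-spec ya))))

    label : Fin n → ℕ
    label a = indexOf _≟ᶠ_ a (lightPlayers (top a))

    label<bound : ∀ {y a} → Light y a → label a < bound T p
    label<bound ya =
      <-≤-trans (indexOf-< _≟ᶠ_ (∈-lightPlayers⁺ top-light)) (length-lightPlayers≤bound (proj₁ top-light))
      where
      top-light : Light (top _) _
      top-light = proj₁ (top-spec ya)

    label-injective : ∀ {y a b} → Light y a → Light y b → label a ≡ label b → a ≡ b
    label-injective {a = a} {b} ya yb la≡lb =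
      indexOf-injective _≟ᶠ_ (∈-lightPlayers⁺ (proj₁ (top-spec ya))) b∈
        (trans la≡lb (cong index-of-b (sym tops)))
      where
      tops : top a ≡ top b
      tops = top-shared ya yb
      index-of-b : Fin n → ℕ
      index-of-b t = indexOf _≟ᶠ_ b (lightPlayers t)
      b∈ : b ∈ lightPlayers (top a)
      b∈ = subst (λ t → b ∈ lightPlayers t) (sym tops) (∈-lightPlayers⁺ (proj₁ (top-spec yb)))

    -- Case analysis on the search goes through `select` and `labelled-spec`: a `with` on
    -- it would normalise `label` inside the goal, which is prohibitively expensive.
    private
      LightLabelled : ℕ → Fin n → Set
      LightLabelled i z = ∃[ b ] (Light z b × label b ≡ i)

      select : ∀ {i z} → Dec (LightLabelled i z) → Fin n
      select {z = z} (yes (b , _)) = childContaining z b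
      select {z = z} (no _)        = heavy z

    labelled : ℕ → Fin n → Fin n
    labelled i z = select (any? (λ b → Light? z b ×-dec (label b ≟ i)))

    labelled-spec : ∀ i z → ∃[ b ] (Light z b × label b ≡ i × labelled i z ≡ childContaining z b)
                           ⊎ ((∀ b → Light z b → label b ≢ i) × labelled i z ≡ heavy z)
    labelled-spec i z = spec (any? (λ b → Light? z b ×-dec (label b ≟ i)))
      where
      spec : (d : Dec (LightLabelled i z)) → ∃[ b ] (Light z b × label b ≡ i × select d ≡ childContaining z b)
                                            ⊎ ((∀ b → Light z b → label b ≢ i) × select d ≡ heavy z)
      spec (yes (b , zb , lb≡i)) = inj₁ (b , zb , lb≡i , refl)
      spec (no none)             = inj₂ ((λ b zb lb≡i → none (b , zb , lb≡i)) , refl)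

    labelled-↝ : ∀ i {z} → ¬ Source T z → labelled i z ↝ z
    labelled-↝ i {z} ns = [ (λ (b , _ , _ , eq) → subst (_↝ z) (sym eq) (childContaining-↝ b ns))
                          , (λ (_ , eq) → subst (_↝ z) (sym eq) (proj₁ (heavy-spec ns))) ]′
                          (labelled-spec i z)

    module Labelled (i : ℕ) = Selection (labelled i) (labelled-↝ i)

    labelled-wins : ∀ {x a} → Light x a → Labelled.winner (label a) x ≡ a
    labelled-wins {x} {a} xa@(_ , x∋a , _) = Labelled.winner-follows (label a) x∋a follows
      where
      follows : ∀ {v} → ¬ Source T v → Walk T v x → InP T v a → InP T (labelled (label a) v) a
      follows {v} ns vx va = [ via-light , via-heavy ]′ (labelled-spec (label a) v)
        where
        via-light : ∃[ b ] (Light v b × label b ≡ label a × labelled (label a) v ≡ childContaining v b) →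
                    InP T (labelled (label a) v) a
        via-light (b , vb , lb≡la , eq) = subst (λ u → InP T u a) (sym eq)
          (subst (λ c → InP T (childContaining v c) a) (label-injective xa (light-transfer va vb vx xa) (sym lb≡la))
                 (childContaining-InP ns va))
        via-heavy : (∀ b → Light v b → label b ≢ label a) × labelled (label a) v ≡ heavy v →
                    InP T (labelled (label a) v) a
        via-heavy (none , eq) = subst (λ u → InP T u a) (sym eq)
          (decidable-stable (InP? (heavy v) a) (λ ¬ha → none a (ns , va , ¬ha) refl))

    labelledBrackets : List (Bracket T)
    labelledBrackets = map Labelled.bracket (upTo (bound T p))

    length-labelledBrackets : length labelledBrackets ≡ bound T p
    length-labelledBrackets = trans (length-map Labelled.bracket (upTo (bound T p))) (length-upTo (bound T p))

    module _ (ℝ : RealField) where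
      open RealField ℝ using (_≈_; isStrictTotalOrder)
      open RealFieldProperties ℝ
      open IsStrictTotalOrder isStrictTotalOrder using () renaming (_≟_ to _≟ℝ_)

      -- Decreasing powers of two along allFin n: each weight exceeds the sum of the later ones.
      weight : Fin n → ℕ
      weight x = 2 ^ (n ∸ suc (toℕ x))

      binaryScoring : ScoringSystem T ℝ
      binaryScoring = record { σ = fromℕ ∘ weight ; pos = λ x _ → fromℕ-<-mono (m^n>0 2 (n ∸ suc (toℕ x))) }

      agreements : Bracket T → Bracket T → Fin n → Bool
      agreements b c x = not (isSource T x) ∧ does (B b x ≟ᶠ B c x)

      binaryScore : ∀ b c → score T ℝ binaryScoring b c ≈ fromℕ (subsetSum weight (agreements b c) (allFin n))
      binaryScore b c = fromℕ-subsetSum weight (agreements b c) (allFin n)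

      binaryScore≈⇒agrees : ∀ {b c d} → score T ℝ binaryScoring b c ≈ score T ℝ binaryScoring b d →
                           ∀ {x} → ¬ Source T x → B b x ≡ B c x → B b x ≡ B d x
      binaryScore≈⇒agrees {b} {c} {d} scores≈ {x} ns bc = decidable-stable (B b x ≟ᶠ B d x) λ ¬bd →
        contradiction (trans (sym bit-d) (dec-false (B b x ≟ᶠ B d x) ¬bd)) λ ()
        where
        same-sum : subsetSum weight (agreements b c) (allFin n) ≡ subsetSum weight (agreements b d) (allFin n)
        same-sum = fromℕ-injective (R.trans (R.sym (binaryScore b c)) (R.trans scores≈ (binaryScore b d)))
        same-bit : does (B b x ≟ᶠ B c x) ≡ does (B b x ≟ᶠ B d x)
        same-bit = subst (λ s → not s ∧ does (B b x ≟ᶠ B c x) ≡ not s ∧ does (B b x ≟ᶠ B d x))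
          (isSource-false ns)
          (subsetSum-injective weight
            (proj₁ (descendingPowers-superincreasing weight n (λ x → x) (λ _ → refl))) same-sum (∈-allFin x))
        bit-d : does (B b x ≟ᶠ B d x) ≡ true
        bit-d = trans (sym same-bit) (dec-true (B b x ≟ᶠ B c x) bc)

      private
        AllScoresEqual : Bracket T → Bracket T → Set
        AllScoresEqual b b′ =
          All (λ bi → score T ℝ binaryScoring bi b ≈ score T ℝ binaryScoring bi b′) labelledBrackets

        light-winner-agrees : ∀ {b b′ v} → AllScoresEqual b b′ → Light v (B b v) → B b v ≡ B b′ v
        light-winner-agrees {b} {b′} {v} same light@(ns , _) =
          trans (sym wins) (binaryScore≈⇒agrees {bi} {b} {b′} (ListAll.lookup same bi∈) ns wins)
          where
          bi = Labelled.bracket (label (B b v))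
          wins : B bi v ≡ B b v
          wins = labelled-wins light
          bi∈ : bi ∈ labelledBrackets
          bi∈ = ∈-map⁺ Labelled.bracket (∈-upTo⁺ (label<bound light))

      decode : ∀ {b b′} → AllScoresEqual b b′ → ∀ v → B b v ≡ B b′ v
      decode {b} {b′} same = ↝-rec _ go
        where
        go : ∀ v → (∀ {u} → u ↝ v → B b u ≡ B b′ u) → B b v ≡ B b′ v
        go v rec = by-cases (source? v)
          where
          from-heavy : ¬ Source T v → Dec (InP T (heavy v) (B b v)) → Dec (InP T (heavy v) (B b′ v)) →
                       B b v ≡ B b′ v
          from-heavy ns (no ¬hb) _        = light-winner-agrees {b} {b′} same (ns , B-InP b v , ¬hb)
          from-heavy ns (yes _)  (no ¬hb′) =
            sym (light-winner-agrees {b′} {b} (ListAll.map R.sym same) (ns , B-InP b′ v , ¬hb′))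
          from-heavy ns (yes hb) (yes hb′) = begin
            B b v            ≡⟨ winner-step b h↝v hb ⟨
            B b (heavy v)    ≡⟨ rec h↝v ⟩
            B b′ (heavy v)   ≡⟨ winner-step b′ h↝v hb′ ⟩
            B b′ v           ∎
            where
            open ≡-Reasoning
            h↝v = proj₁ (heavy-spec ns)

          by-cases : Dec (Source T v) → B b v ≡ B b′ v
          by-cases (yes s) = trans (onPlayer b v s) (sym (onPlayer b′ v s))
          by-cases (no ns) = from-heavy ns (InP? (heavy v) (B b v)) (InP? (heavy v) (B b′ v))

      labelledBrackets-resolve : Resolving T ℝ binaryScoring labelledBrackets
      labelledBrackets-resolve b b′ b≢b′ =
        find (¬All⇒Any¬ (λ bi → score T ℝ binaryScoring bi b ≟ℝ score T ℝ binaryScoring bi b′)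
                        labelledBrackets (b≢b′ ∘ decode {b} {b′}))

theorem1p8 : (ℝ : RealField) (T : Digraph) → IsSET T → 2 ≤ numPlayers T →
    (p : Fin (Digraph.n T) → ℕ) → (∀ v → HasSize (InP T v) (p v)) →
    ((σ : ScoringSystem T ℝ) (Bs : List (Bracket T)) →
       Resolving T ℝ σ Bs → bound T p ≤ length Bs)
    × Σ (ScoringSystem T ℝ) (λ σ → Σ (List (Bracket T)) (λ Bs →
        Resolving T ℝ σ Bs × length Bs ≡ bound T p))
theorem1p8 ℝ T isSET _ p hasSize =
  lower-bound ℝ , binaryScoring ℝ , labelledBrackets , labelledBrackets-resolve ℝ , length-labelledBrackets
  where open Tournament T isSET
        open PlayerCounts p hasSize
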